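{- Let $\mathcal{K}$ be a coronoid and write $\mathcal{H}\setminus\mathcal{K}=\mathcal{B}_\infty\sqcup\mathcal{B}_1\sqcup\cdots\sqcup\mathcal{B}_d$, where $\mathcal{B}_\infty$ is the unique infinite connected component of $\mathcal{H}\setminus\mathcal{K}$ and $\mathcal{B}_1,\dots,\mathcal{B}_d$ are the finite ones. Then the benzenoid closure $\overline{\mathcal{K}}$ is a benzenoid, and $\overline{\mathcal{K}}=\mathcal{H}\setminus\mathcal{B}_\infty=\mathcal{K}\sqcup\mathcal{B}_1\sqcup\cdots\sqcup\mathcal{B}_d$.
   Context: $\mathcal{H}$ is the set of hexagons of the regular hexagonal tiling of the plane; hexagons are adjacent if distinct and sharing an edge; a hexagonal system is a subset of $\mathcal{H}$, and its connected components are the classes of the relation "joined by a sequence of hexagons of the system, consecutive ones adjacent"; it is connected if it has exactly one component. A coronoid is a finite connected hexagonal system; a benzenoid is a coronoid whose complement in $\mathcal{H}$ is connected. The complement of a coronoid has finitely many components, exactly one of them infinite. The benzenoid closure of a coronoid $\mathcal{K}$ is $\overline{\mathcal{K}}=\bigcap\{\mathcal{B}:\mathcal{B}\text{ a benzenoid},\ \mathcal{K}\subseteq\mathcal{B}\}$. -}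

module Defs where

open import Data.Integer using (ℤ; +_; -[1+_]; _-_)
open import Data.Product using (_×_; Σ; ∃; _,_)
open import Data.Sum using (_⊎_)
open import Data.Bool using (Bool; true; false; not)
open import Data.List using (List)
open import Data.List.Membership.Propositional using (_∈_)
open import Relation.Binary.PropositionalEquality using (_≡_)
open import Relation.Nullary using (¬_)

-- Hexagons of the regular hexagonal tiling, in axial coordinates.
Hex : Set
Hex = ℤ × ℤ

data Dir : ℤ × ℤ → Set where
  d1 : Dir (+ 1 , + 0)
  d2 : Dir (-[1+ 0 ] , + 0)
  d3 : Dir (+ 0 , + 1)
  d4 : Dir (+ 0 , -[1+ 0 ])
  d5 : Dir (+ 1 , -[1+ 0 ])
  d6 : Dir (-[1+ 0 ] , + 1)

Adj : Hex → Hex → Set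
Adj (a₁ , a₂) (b₁ , b₂) = Dir (b₁ - a₁ , b₂ - a₂)

HexSystem : Set
HexSystem = Hex → Bool

_∈ₛ_ : Hex → HexSystem → Set
h ∈ₛ S = S h ≡ true

complement : HexSystem → HexSystem
complement S h = not (S h)

data Joined (S : HexSystem) : Hex → Hex → Set where
  here : ∀ {a} → a ∈ₛ S → Joined S a a
  step : ∀ {a b c} → a ∈ₛ S → Adj a b → Joined S b c → Joined S a c

FinitePred : (Hex → Set) → Set
FinitePred P = Σ (List Hex) λ xs → ∀ h → P h → h ∈ xs

Finite : HexSystem → Set
Finite S = FinitePred (λ h → h ∈ₛ S)

Connected : HexSystem → Set
Connected S = (∃ λ h → h ∈ₛ S) × (∀ a b → a ∈ₛ S → b ∈ₛ S → Joined S a b)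

Coronoid : HexSystem → Set
Coronoid K = Finite K × Connected K

Benzenoid : HexSystem → Set
Benzenoid B = Coronoid B × Connected (complement B)

_⊆ₛ_ : HexSystem → HexSystem → Set
K ⊆ₛ B = ∀ h → h ∈ₛ K → h ∈ₛ B

Closure : HexSystem → Hex → Set
Closure K h = ∀ (B : HexSystem) → Benzenoid B → K ⊆ₛ B → h ∈ₛ B

Component : HexSystem → Hex → Hex → Set
Component S h g = Joined S h g

InInfComp : HexSystem → Hex → Set
InInfComp K h = h ∈ₛ complement K × ¬ FinitePred (Component (complement K) h)

InFinComp : HexSystem → Hex → Set
InFinComp K h = h ∈ₛ complement K × FinitePred (Component (complement K) h)

-- Fix M bounding max(|a|,|b|) over the hexagons (a,b) of K.  The hexagons of norm > M lie
-- outside K and are joined to one another along rows and columns, so they lie in one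
-- component of H \ K, which is infinite; any other component is confined to the square
-- of radius M and is finite.  Whether a hexagon reaches that far region through H \ K
-- is decided by saturating a reachable set inside the finite square, so the filling
-- "hexagons that do not reach it" is a genuine system, equal to
-- H \ B∞ = K ⊔ B₁ ⊔ … ⊔ B_d.
-- It is finite, connected (a row walked from any of its hexagons meets K before it can
-- escape) and has connected complement B∞.  Conversely, a benzenoid B ⊇ K is finite and
-- its complement is connected, so it joins every hexagon outside B to the far region
-- within H \ K: such a hexagon is not in the filling.
module Submission where

open import Defs
open import Data.Bool using (true; false; not)
import Data.Bool as Bool
open import Data.Empty using (⊥-elim)
open import Data.Integer using (ℤ; +_; -[1+_]; _+_; _-_; -_; ∣_∣)
import Data.Integer.Properties as ℤ
open import Data.Integer.Tactic.RingSolver using (solve-∀)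
open import Data.List
  using (List; []; _∷_; _++_; map; foldr; length; filter; upTo; cartesianProduct)
open import Data.List.Membership.Propositional using (_∈_; _∉_; find; lose)
open import Data.List.Membership.Propositional.Properties
  using ( ∈-map⁺; ∈-map⁻; ∈-++⁺ˡ; ∈-++⁺ʳ; ∈-++⁻; ∈-upTo⁺; ∈-cartesianProduct⁺
        ; ∈-filter⁺; ∈-filter⁻)
open import Data.List.Properties using (filter-notAll)
open import Data.List.Relation.Unary.Any using (Any; here; there; any?)
import Data.List.Relation.Unary.Any as Any
open import Data.Nat using (ℕ; zero; suc; _≤_; _<_; _⊔_; s≤s; _<?_)
import Data.Nat.Properties as ℕ
open import Data.Nat.Induction using (<-wellFounded)
open import Data.Product using (_×_; Σ; ∃; _,_; proj₁; proj₂)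
open import Data.Product.Properties using (≡-dec)
open import Data.Sum using (_⊎_; inj₁; inj₂)
open import Function using (_∘_)
open import Function.Bundles using (_⇔_; mk⇔; Equivalence)
open import Induction.WellFounded using (Acc; acc)
open import Relation.Binary.PropositionalEquality
  using (_≡_; refl; sym; trans; cong; cong₂; subst)
open import Relation.Nullary using (¬_; Dec; yes; no; does)
open import Relation.Nullary.Decidable using (_×-dec_; _⊎-dec_)
open import Relation.Unary using (Decidable)
open import Relation.Unary.Properties using (∁?)


_⊕_ : Hex → ℤ × ℤ → Hex
(x₁ , x₂) ⊕ (d₁ , d₂) = x₁ + d₁ , x₂ + d₂

offset : Hex → Hex → ℤ × ℤ
offset (x₁ , x₂) (y₁ , y₂) = y₁ - x₁ , y₂ - x₂

offset-⊕ : ∀ x d → offset x (x ⊕ d) ≡ d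
offset-⊕ (x₁ , x₂) (d₁ , d₂) = cong₂ _,_ (lemma x₁ d₁) (lemma x₂ d₂)
  where
  lemma : ∀ x d → (x + d) - x ≡ d
  lemma = solve-∀

⊕-offset : ∀ x y → x ⊕ offset x y ≡ y
⊕-offset (x₁ , x₂) (y₁ , y₂) = cong₂ _,_ (lemma x₁ y₁) (lemma x₂ y₂)
  where
  lemma : ∀ x y → x + (y - x) ≡ y
  lemma = solve-∀

offset-swap : ∀ x y → offset y x ≡ (- proj₁ (offset x y) , - proj₂ (offset x y))
offset-swap (x₁ , x₂) (y₁ , y₂) = cong₂ _,_ (lemma x₁ y₁) (lemma x₂ y₂)
  where
  lemma : ∀ x y → x - y ≡ - (y - x)
  lemma = solve-∀

+1-minus : ∀ t → (t + + 1) - t ≡ + 1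
+1-minus = solve-∀

Dir-neg : ∀ {d₁ d₂} → Dir (d₁ , d₂) → Dir (- d₁ , - d₂)
Dir-neg d1 = d2
Dir-neg d2 = d1
Dir-neg d3 = d4
Dir-neg d4 = d3
Dir-neg d5 = d6
Dir-neg d6 = d5

Adj-via : ∀ x y {d} → Dir d → offset x y ≡ d → Adj x y
Adj-via _ _ dir eq = subst Dir (sym eq) dir

Adj-sym : ∀ {x y} → Adj x y → Adj y x
Adj-sym {x} {y} x~y = Adj-via y x (Dir-neg x~y) (offset-swap x y)

Adj-east : ∀ a b → Adj (a , b) (a + + 1 , b)
Adj-east a b = Adj-via (a , b) (a + + 1 , b) d1 (cong₂ _,_ (+1-minus a) (ℤ.+-inverseʳ b))

Adj-north : ∀ a b → Adj (a , b) (a , b + + 1)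
Adj-north a b = Adj-via (a , b) (a , b + + 1) d3 (cong₂ _,_ (ℤ.+-inverseʳ a) (+1-minus b))

directions : List (ℤ × ℤ)
directions = (+ 1 , + 0) ∷ (-[1+ 0 ] , + 0) ∷ (+ 0 , + 1) ∷ (+ 0 , -[1+ 0 ])
           ∷ (+ 1 , -[1+ 0 ]) ∷ (-[1+ 0 ] , + 1) ∷ []

Dir⇒∈directions : ∀ {d} → Dir d → d ∈ directions
Dir⇒∈directions d1 = here refl
Dir⇒∈directions d2 = there (here refl)
Dir⇒∈directions d3 = there (there (here refl))
Dir⇒∈directions d4 = there (there (there (here refl)))
Dir⇒∈directions d5 = there (there (there (there (here refl))))
Dir⇒∈directions d6 = there (there (there (there (there (here refl)))))

∈directions⇒Dir : ∀ {d} → d ∈ directions → Dir d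
∈directions⇒Dir (here refl) = d1
∈directions⇒Dir (there (here refl)) = d2
∈directions⇒Dir (there (there (here refl))) = d3
∈directions⇒Dir (there (there (there (here refl)))) = d4
∈directions⇒Dir (there (there (there (there (here refl))))) = d5
∈directions⇒Dir (there (there (there (there (there (here refl)))))) = d6

neighbours : Hex → List Hex
neighbours x = map (x ⊕_) directions

Adj⇒∈neighbours : ∀ {x y} → Adj x y → y ∈ neighbours x
Adj⇒∈neighbours {x} {y} x~y =
  subst (_∈ neighbours x) (⊕-offset x y) (∈-map⁺ (x ⊕_) (Dir⇒∈directions x~y))

∈neighbours⇒Adj : ∀ {x y} → y ∈ neighbours x → Adj x y
∈neighbours⇒Adj {x} y∈ with d , d∈ , refl ← ∈-map⁻ (x ⊕_) y∈ =
  Adj-via x (x ⊕ d) (∈directions⇒Dir d∈) (offset-⊕ x d)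

_∈ₛ?_ : ∀ h S → Dec (h ∈ₛ S)
h ∈ₛ? S = S h Bool.≟ true

∈complement⁺ : ∀ {S h} → ¬ h ∈ₛ S → h ∈ₛ complement S
∈complement⁺ {S} {h} h∉S with S h
... | true = ⊥-elim (h∉S refl)
... | false = refl

∈complement⁻ : ∀ {S h} → h ∈ₛ complement S → ¬ h ∈ₛ S
∈complement⁻ {S} {h} h∈Sᶜ h∈S with S h
∈complement⁻ () refl | true

complement-anti : ∀ {S T} → S ⊆ₛ T → complement T ⊆ₛ complement S
complement-anti {S} {T} S⊆T h h∈Tᶜ = ∈complement⁺ {S} (∈complement⁻ {T} h∈Tᶜ ∘ S⊆T h)

Joined-start : ∀ {S a b} → Joined S a b → a ∈ₛ S
Joined-start (here a∈S) = a∈S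
Joined-start (step a∈S _ _) = a∈S

Joined-trans : ∀ {S a b c} → Joined S a b → Joined S b c → Joined S a c
Joined-trans (here _) b⇝c = b⇝c
Joined-trans (step a∈S a~ j) b⇝c = step a∈S a~ (Joined-trans j b⇝c)

Joined-sym : ∀ {S a b} → Joined S a b → Joined S b a
Joined-sym (here a∈S) = here a∈S
Joined-sym (step {a} {v} a∈S a~v v⇝b) =
  Joined-trans (Joined-sym v⇝b) (step (Joined-start v⇝b) (Adj-sym {a} {v} a~v) (here a∈S))

Joined-mono : ∀ {S T a b} → S ⊆ₛ T → Joined S a b → Joined T a b
Joined-mono S⊆T (here a∈S) = here (S⊆T _ a∈S)
Joined-mono S⊆T (step a∈S a~ j) = step (S⊆T _ a∈S) a~ (Joined-mono S⊆T j)

Joined-narrow : ∀ {S T a r} → (∀ p → Joined S p r → p ∈ₛ T) → Joined S a r → Joined T a r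
Joined-narrow into (here a∈S) = here (into _ (here a∈S))
Joined-narrow into (step a∈S a~ j) = step (into _ (step a∈S a~ j)) a~ (Joined-narrow into j)

module _ {S : HexSystem} (f : ℤ → Hex) (f-adj : ∀ t → Adj (f t) (f (t + + 1)))
         (f-∈ : ∀ t → f t ∈ₛ S) where

  Joined-line⁺ : ∀ s n → Joined S (f s) (f (s + + n))
  Joined-line⁺ s zero =
    subst (Joined S (f s) ∘ f) (sym (ℤ.+-identityʳ s)) (here (f-∈ s))
  Joined-line⁺ s (suc n) =
    subst (Joined S (f s) ∘ f) (ℤ.+-assoc s (+ 1) (+ n))
          (step (f-∈ s) (f-adj s) (Joined-line⁺ (s + + 1) n))

  Joined-line : ∀ s t → Joined S (f s) (f t)
  Joined-line s t with t - s in eq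
  ... | + n = subst (Joined S (f s) ∘ f) s+n≡t (Joined-line⁺ s n)
    where
    s+n≡t : s + + n ≡ t
    s+n≡t = trans (cong (λ z → s + z) (sym eq)) (lemma s t)
      where
      lemma : ∀ s t → s + (t - s) ≡ t
      lemma = solve-∀
  ... | -[1+ n ] = Joined-sym (subst (Joined S (f t) ∘ f) t+n≡s (Joined-line⁺ t (suc n)))
    where
    t+n≡s : t + + suc n ≡ s
    t+n≡s = trans (cong (λ z → t + - z) (sym eq)) (lemma s t)
      where
      lemma : ∀ s t → t + - (t - s) ≡ s
      lemma = solve-∀

Joined-row : ∀ {S} b → (∀ a → (a , b) ∈ₛ S) → ∀ a a' → Joined S (a , b) (a' , b)
Joined-row b = Joined-line (_, b) (λ a → Adj-east a b)

Joined-column : ∀ {S} a → (∀ b → (a , b) ∈ₛ S) → ∀ b b' → Joined S (a , b) (a , b')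
Joined-column a = Joined-line (a ,_) (Adj-north a)

norm : Hex → ℕ
norm (a , b) = ∣ a ∣ ⊔ ∣ b ∣

Out : ℕ → Hex → Set
Out M h = M < norm h

Out? : ∀ M → Decidable (Out M)
Out? M h = M <? norm h

bound : List Hex → ℕ
bound = foldr (λ h m → norm h ⊔ m) 0

norm≤bound : ∀ {h ys} → h ∈ ys → norm h ≤ bound ys
norm≤bound (here refl) = ℕ.m≤m⊔n _ _
norm≤bound {ys = y ∷ _} (there h∈ys) = ℕ.m≤n⇒m≤o⊔n (norm y) (norm≤bound h∈ys)

Out-bound⇒∉ : ∀ {h ys} → Out (bound ys) h → h ∉ ys
Out-bound⇒∉ out h∈ys = ℕ.<⇒≱ out (norm≤bound h∈ys)

∃-Out-∉ : ∀ M ys → ∃ λ g → Out M g × g ∉ ys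
∃-Out-∉ M ys =
  g , ℕ.≤-<-trans (ℕ.m≤m⊔n M _) N<∣g∣ , Out-bound⇒∉ (ℕ.≤-<-trans (ℕ.m≤n⊔m M _) N<∣g∣)
  where
  N : ℕ
  N = M ⊔ bound ys
  g : Hex
  g = + suc N , + 0
  N<∣g∣ : Out N g
  N<∣g∣ = ℕ.n<1+n N

integers : ℕ → List ℤ
integers M = map +_ (upTo (suc M)) ++ map -[1+_] (upTo M)

∣∣≤⇒∈integers : ∀ {M} z → ∣ z ∣ ≤ M → z ∈ integers M
∣∣≤⇒∈integers (+ n) n≤M = ∈-++⁺ˡ (∈-map⁺ +_ (∈-upTo⁺ (s≤s n≤M)))
∣∣≤⇒∈integers {M} -[1+ n ] n<M =
  ∈-++⁺ʳ (map +_ (upTo (suc M))) (∈-map⁺ -[1+_] (∈-upTo⁺ n<M))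

square : ℕ → List Hex
square M = cartesianProduct (integers M) (integers M)

¬Out⇒∈square : ∀ {M} h → ¬ Out M h → h ∈ square M
¬Out⇒∈square {M} (a , b) ¬out = ∈-cartesianProduct⁺
  (∣∣≤⇒∈integers a (ℕ.m⊔n≤o⇒m≤o ∣ a ∣ ∣ b ∣ norm≤M))
  (∣∣≤⇒∈integers b (ℕ.m⊔n≤o⇒n≤o ∣ a ∣ ∣ b ∣ norm≤M))
  where
  norm≤M : norm (a , b) ≤ M
  norm≤M = ℕ.≮⇒≥ ¬out

corner : ℕ → Hex
corner M = + suc M , + suc M

Out-corner : ∀ M → Out M (corner M)
Out-corner M = ℕ.m<n⇒m<n⊔o (suc M) (ℕ.n<1+n M)

Out-column : ∀ {M} a → M < ∣ a ∣ → ∀ b → Out M (a , b)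
Out-column _ M<∣a∣ b = ℕ.m<n⇒m<n⊔o ∣ b ∣ M<∣a∣

Out-row : ∀ {M} b → M < ∣ b ∣ → ∀ a → Out M (a , b)
Out-row _ M<∣b∣ a = ℕ.m<n⇒m<o⊔n ∣ a ∣ M<∣b∣

-- Walk along the line whose coordinate exceeds M to the row or column through the corner.
Out⇒Joined-corner : ∀ {S M h} → (∀ g → Out M g → g ∈ₛ S) → Out M h →
                    Joined S h (corner M)
Out⇒Joined-corner {S} {M} {a , b} Out⊆S out with ℕ.⊔-sel ∣ a ∣ ∣ b ∣
... | inj₁ norm≡∣a∣ =
  Joined-trans (Joined-column a (Out⊆S _ ∘ Out-column a (subst (M <_) norm≡∣a∣ out)) b (+ suc M))
               (Joined-row (+ suc M) (Out⊆S _ ∘ Out-row (+ suc M) (ℕ.n<1+n M)) a (+ suc M))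
... | inj₂ norm≡∣b∣ =
  Joined-trans (Joined-row b (Out⊆S _ ∘ Out-row b (subst (M <_) norm≡∣b∣ out)) a (+ suc M))
               (Joined-column (+ suc M) (Out⊆S _ ∘ Out-column (+ suc M) (ℕ.n<1+n M)) b (+ suc M))

-- Reaching a decidable target G inside S is decidable once the hexagons outside G are
-- enumerated by a finite box: hexagons of S adjacent to a known one are moved from the
-- pending part of the box to the reached part until none is left.
module Reachability (S : HexSystem) {G : Hex → Set} (G? : Decidable G)
                    (box : List Hex) (box-complete : ∀ h → ¬ G h → h ∈ box) where

  Reaches : Hex → Set
  Reaches h = ∃ λ r → G r × Joined S h r

  Known : List Hex → Hex → Set
  Known reached v = (v ∈ₛ S × G v) ⊎ v ∈ reached

  Frontier : List Hex → Hex → Set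
  Frontier reached x = x ∈ₛ S × Any (Known reached) (neighbours x)

  frontier? : ∀ reached → Decidable (Frontier reached)
  frontier? reached x = (x ∈ₛ? S) ×-dec any? known? (neighbours x)
    where
    known? : Decidable (Known reached)
    known? v = ((v ∈ₛ? S) ×-dec G? v) ⊎-dec any? (≡-dec ℤ._≟_ ℤ._≟_ v) reached

  Covers : List Hex → List Hex → Set
  Covers pending reached = ∀ h → ¬ G h → h ∈ pending ⊎ h ∈ reached

  AllReach : List Hex → Set
  AllReach reached = ∀ h → h ∈ reached → Reaches h

  frontier-reaches : ∀ {reached x} → AllReach reached → Frontier reached x → Reaches x
  frontier-reaches {reached} all (x∈S , any) with v , v∈nbrs , known ← find any =
    let r , Gr , v⇝r = known-reaches known
    in r , Gr , step x∈S (∈neighbours⇒Adj v∈nbrs) v⇝r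
    where
    known-reaches : ∀ {v} → Known reached v → Reaches v
    known-reaches {v} (inj₁ (v∈S , Gv)) = v , Gv , here v∈S
    known-reaches {v} (inj₂ v∈reached) = all v v∈reached

  record Saturation : Set where
    field
      pending reached : List Hex
      covers : Covers pending reached
      reached-reaches : AllReach reached
      saturated : ∀ h → h ∈ pending → ¬ Frontier reached h

  saturate : ∀ pending reached → Acc _<_ (length pending) →
             Covers pending reached → AllReach reached → Saturation
  saturate pending reached (acc smaller) covers all with any? (frontier? reached) pending
  ... | no none = record { pending = pending ; reached = reached ; covers = covers
                         ; reached-reaches = all ; saturated = λ h h∈ f → none (lose h∈ f) }
  ... | yes some = saturate rest (fresh ++ reached) (smaller shrinks) covers′ all′
    where
    F? : Decidable (Frontier reached)
    F? = frontier? reached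
    fresh rest : List Hex
    fresh = filter F? pending
    rest = filter (∁? F?) pending
    shrinks : length rest < length pending
    shrinks = filter-notAll (∁? F?) pending (Any.map (λ f ¬f → ¬f f) some)
    covers′ : Covers rest (fresh ++ reached)
    covers′ h ¬Gh with covers h ¬Gh
    ... | inj₂ h∈reached = inj₂ (∈-++⁺ʳ fresh h∈reached)
    ... | inj₁ h∈pending with F? h
    ...   | yes f = inj₂ (∈-++⁺ˡ (∈-filter⁺ F? h∈pending f))
    ...   | no ¬f = inj₁ (∈-filter⁺ (∁? F?) h∈pending ¬f)
    all′ : AllReach (fresh ++ reached)
    all′ h h∈ with ∈-++⁻ fresh h∈
    ... | inj₁ h∈fresh = frontier-reaches all (proj₂ (∈-filter⁻ F? {xs = pending} h∈fresh))
    ... | inj₂ h∈reached = all h h∈reached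

  saturation : Saturation
  saturation =
    saturate box [] (<-wellFounded _) (λ h ¬Gh → inj₁ (box-complete h ¬Gh)) (λ _ ())

  open Saturation saturation

  pending-isolated : ∀ {h r} → h ∈ pending → ¬ G h → Joined S h r → ¬ G r
  pending-isolated h∈ ¬Gh (here _) = ¬Gh
  pending-isolated {h} h∈ ¬Gh (step {b = v} h∈S h~v v⇝r) =
    pending-isolated v∈pending ¬Gv v⇝r
    where
    unknown : ¬ Known reached v
    unknown k = saturated h h∈ (h∈S , lose (Adj⇒∈neighbours h~v) k)
    ¬Gv : ¬ G v
    ¬Gv Gv = unknown (inj₁ (Joined-start v⇝r , Gv))
    v∈pending : v ∈ pending
    v∈pending with covers v ¬Gv
    ... | inj₁ v∈pending = v∈pending
    ... | inj₂ v∈reached = ⊥-elim (unknown (inj₂ v∈reached))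

  reaches? : Decidable Reaches
  reaches? h with G? h
  ... | yes Gh with h ∈ₛ? S
  ...   | yes h∈S = yes (h , Gh , here h∈S)
  ...   | no h∉S = no (λ (_ , _ , h⇝r) → h∉S (Joined-start h⇝r))
  reaches? h | no ¬Gh with covers h ¬Gh
  ... | inj₁ h∈pending = no (λ (_ , Gr , h⇝r) → pending-isolated h∈pending ¬Gh h⇝r Gr)
  ... | inj₂ h∈reached = yes (reached-reaches h h∈reached)

-- Escapes h: h is joined within H \ K to a hexagon of norm > M, i.e. h lies in B∞.
module Filling (K : HexSystem) (M : ℕ) (Out⊆Kᶜ : ∀ h → Out M h → h ∈ₛ complement K) where

  open Reachability (complement K) (Out? M) (square M) ¬Out⇒∈square
    renaming (Reaches to Escapes; reaches? to escapes?)
    using ()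

  filled : HexSystem
  filled h = not (does (escapes? h))

  ∈filled⁺ : ∀ {h} → ¬ Escapes h → h ∈ₛ filled
  ∈filled⁺ {h} ¬esc with escapes? h
  ... | yes esc = ⊥-elim (¬esc esc)
  ... | no _ = refl

  ∈filled⁻ : ∀ h → h ∈ₛ filled → ¬ Escapes h
  ∈filled⁻ h h∈ with escapes? h
  ∈filled⁻ _ () | yes _
  ... | no ¬esc = ¬esc

  ∉filled⇒Escapes : ∀ {h} → ¬ h ∈ₛ filled → Escapes h
  ∉filled⇒Escapes {h} h∉ with escapes? h
  ... | yes esc = esc
  ... | no ¬esc = ⊥-elim (h∉ refl)

  Out⇒Escapes : ∀ {h} → Out M h → Escapes h
  Out⇒Escapes {h} out = h , out , here (Out⊆Kᶜ h out)

  K⊆filled : K ⊆ₛ filled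
  K⊆filled h h∈K = ∈filled⁺ (λ (_ , _ , h⇝r) → ∈complement⁻ {K} (Joined-start h⇝r) h∈K)

  escape-route : ∀ {h} → Escapes h → Joined (complement K) h (corner M)
  escape-route (_ , out , h⇝r) = Joined-trans h⇝r (Out⇒Joined-corner Out⊆Kᶜ out)

  ¬Escapes⇒component-finite : ∀ {h} → ¬ Escapes h → FinitePred (Component (complement K) h)
  ¬Escapes⇒component-finite ¬esc =
    square M , λ g h⇝g → ¬Out⇒∈square g (λ out → ¬esc (g , out , h⇝g))

  Escapes⇒component-infinite : ∀ {h} → Escapes h → ¬ FinitePred (Component (complement K) h)
  Escapes⇒component-infinite esc (ys , component⊆ys) with g , out , g∉ys ← ∃-Out-∉ M ys =
    g∉ys (component⊆ys g (Joined-trans (escape-route esc)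
                                        (Joined-sym (Out⇒Joined-corner Out⊆Kᶜ out))))

  InInfComp⇔Escapes : ∀ h → InInfComp K h ⇔ Escapes h
  InInfComp⇔Escapes h = mk⇔ to from
    where
    to : InInfComp K h → Escapes h
    to (_ , infinite) with escapes? h
    ... | yes esc = esc
    ... | no ¬esc = ⊥-elim (infinite (¬Escapes⇒component-finite ¬esc))
    from : Escapes h → InInfComp K h
    from esc@(_ , _ , h⇝r) = Joined-start h⇝r , Escapes⇒component-infinite esc

  filled-finite : Finite filled
  filled-finite = square M , λ h h∈ → ¬Out⇒∈square h (∈filled⁻ h h∈ ∘ Out⇒Escapes)

  complement-filled-connected : Connected (complement filled)
  complement-filled-connected =
    (corner M , unfilled (corner M) (Out⇒Escapes (Out-corner M))) ,
    λ a b a∉ b∉ → Joined-trans (to-corner a a∉) (Joined-sym (to-corner b b∉))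
    where
    unfilled : ∀ h → Escapes h → h ∈ₛ complement filled
    unfilled h esc = ∈complement⁺ {filled} {h} (λ h∈ → ∈filled⁻ h h∈ esc)
    to-corner : ∀ h → h ∈ₛ complement filled → Joined (complement filled) h (corner M)
    to-corner h h∉ =
      Joined-narrow (λ p p⇝c → unfilled p (corner M , Out-corner M , p⇝c))
                    (escape-route (∉filled⇒Escapes (∈complement⁻ {filled} {h} h∉)))

  -- Before a path first meets K it runs through H \ K, so it cannot escape there.
  path-meets-K : ∀ {U h g} → Joined U h g → h ∈ₛ filled → Out M g →
                 ∃ λ k → k ∈ₛ K × Joined filled h k
  path-meets-K {h = h} (here _) h∈ out = ⊥-elim (∈filled⁻ h h∈ (Out⇒Escapes out))
  path-meets-K {h = h} (step {b = v} _ h~v v⇝g) h∈ out with h ∈ₛ? K | v ∈ₛ? K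
  ... | yes h∈K | _ = h , h∈K , here h∈
  ... | no h∉K | yes v∈K = v , v∈K , step h∈ h~v (here (K⊆filled v v∈K))
  ... | no h∉K | no v∉K =
    let k , k∈K , v⇝k = path-meets-K v⇝g v∈ out in k , k∈K , step h∈ h~v v⇝k
    where
    v∈ : v ∈ₛ filled
    v∈ = ∈filled⁺ {v} λ (r , out , v⇝r) →
      ∈filled⁻ h h∈ (r , out , step {b = v} (∈complement⁺ {K} {h} h∉K) h~v v⇝r)

  filled⇒meets-K : ∀ {h} → h ∈ₛ filled → ∃ λ k → k ∈ₛ K × Joined filled h k
  filled⇒meets-K {a , b} h∈ =
    path-meets-K (Joined-row {λ _ → true} b (λ _ → refl) a (+ suc M)) h∈
                 (Out-column (+ suc M) (ℕ.n<1+n M) b)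

  filled-connected : Connected K → Connected filled
  filled-connected ((k , k∈K) , K-joined) = (k , K⊆filled k k∈K) , joined
    where
    joined : ∀ a b → a ∈ₛ filled → b ∈ₛ filled → Joined filled a b
    joined a b a∈ b∈
      with ka , ka∈K , a⇝ka ← filled⇒meets-K a∈
         | kb , kb∈K , b⇝kb ← filled⇒meets-K b∈ =
      Joined-trans a⇝ka (Joined-trans (Joined-mono K⊆filled (K-joined ka kb ka∈K kb∈K))
                                      (Joined-sym b⇝kb))

  filled-benzenoid : Connected K → Benzenoid filled
  filled-benzenoid K-connected =
    (filled-finite , filled-connected K-connected) , complement-filled-connected

  filled⊆benzenoid : ∀ {B} → Benzenoid B → K ⊆ₛ B → filled ⊆ₛ B
  filled⊆benzenoid {B} (((ys , B⊆ys) , _) , Bᶜ-connected) K⊆B h h∈ with h ∈ₛ? B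
  ... | yes h∈B = h∈B
  ... | no h∉B with g , out , g∉ys ← ∃-Out-∉ M ys =
    ⊥-elim (∈filled⁻ h h∈ (g , out , Joined-mono (complement-anti K⊆B) h⇝g))
    where
    h⇝g : Joined (complement B) h g
    h⇝g = proj₂ Bᶜ-connected h g (∈complement⁺ {B} h∉B) (∈complement⁺ {B} (g∉ys ∘ B⊆ys g))

  Closure⇔filled : Connected K → ∀ h → Closure K h ⇔ h ∈ₛ filled
  Closure⇔filled K-connected h =
    mk⇔ (λ closure → closure filled (filled-benzenoid K-connected) K⊆filled)
        (λ h∈ B B-benzenoid K⊆B → filled⊆benzenoid B-benzenoid K⊆B h h∈)

  ∈filled⇔¬InInfComp : ∀ h → h ∈ₛ filled ⇔ (¬ InInfComp K h)
  ∈filled⇔¬InInfComp h =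
    mk⇔ (λ h∈ → ∈filled⁻ h h∈ ∘ Equivalence.to (InInfComp⇔Escapes h))
        (λ ¬inf → ∈filled⁺ (¬inf ∘ Equivalence.from (InInfComp⇔Escapes h)))

  ∈filled⇔K⊎InFinComp : ∀ h → h ∈ₛ filled ⇔ (h ∈ₛ K ⊎ InFinComp K h)
  ∈filled⇔K⊎InFinComp h = mk⇔ to from
    where
    to : h ∈ₛ filled → h ∈ₛ K ⊎ InFinComp K h
    to h∈ with h ∈ₛ? K
    ... | yes h∈K = inj₁ h∈K
    ... | no h∉K = inj₂ (∈complement⁺ {K} h∉K , ¬Escapes⇒component-finite (∈filled⁻ h h∈))
    from : h ∈ₛ K ⊎ InFinComp K h → h ∈ₛ filled
    from (inj₁ h∈K) = K⊆filled h h∈K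
    from (inj₂ (_ , finite)) = ∈filled⁺ (λ esc → Escapes⇒component-infinite esc finite)

lemma2p11 : (K : HexSystem) → Coronoid K →
    Σ HexSystem λ B →
      (∀ h → Closure K h ⇔ h ∈ₛ B)
      × Benzenoid B
      × (∀ h → h ∈ₛ B ⇔ (¬ InInfComp K h))
      × (∀ h → h ∈ₛ B ⇔ (h ∈ₛ K ⊎ InFinComp K h))
lemma2p11 K ((xs , K⊆xs) , K-connected) =
  filled , Closure⇔filled K-connected , filled-benzenoid K-connected ,
  ∈filled⇔¬InInfComp , ∈filled⇔K⊎InFinComp
  where
  open Filling K (bound xs) (λ h out → ∈complement⁺ {K} {h} (Out-bound⇒∉ out ∘ K⊆xs h))
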